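{- Let $\mathbf{Fin}\subseteq\mathbf{AF}$ be the subspace of finite quivers, and let $\sim$ be the equivalence relation on $\mathbf{Fin}$ generated by finite mutation-equivalence and isomorphism; give $\mathbf{Fin}/\!\sim$ the quotient topology. Then the map $f:\mathbf{Fin}/\!\sim\;\to\mathcal M'$ sending $[Q]_\sim$ to the mutation class of $Q'$, where $Q'$ is the quiver obtained from $Q$ by removing all isolated vertices if $Q$ has at least one arrow, and $Q'$ is the one-vertex quiver if $Q$ has no arrows, is a well-defined homeomorphism.
   Context: $\mathbb{N}$ is the positive integers. A quiver on a set $X$ is a function $Q:X\times X\to\mathbb{Z}$ with $Q(x,y)=-Q(y,x)$. $\mathbf{AF}$ is the set of quivers on $\mathbb{N}$ with the topology generated by the basic sets $U_{Q,V}=\{Q':Q'(x,y)=Q(x,y)\ \forall x,y\in V\}$, $V$ finite. A quiver on $\mathbb{N}$ is finite if $\sum_{x,y}|Q(x,y)|<\infty$. A vertex $x$ is isolated if $Q(x,y)=0$ for all $y$. Mutation at $x$: $\mu_x(Q)(v,w)=-Q(v,w)$ if $x\in\{v,w\}$, otherwise $Q(v,w)+Q(v,x)[Q(x,w)]_++[-Q(v,x)]_+Q(x,w)$, $[a]_+=\max(a,0)$; two quivers are mutation-equivalent if related by a finite sequence of mutations. For a quiver $Q$ on $[n]=\{1,\dots,n\}$ ($n\ge1$), its mutation class $[Q]$ is the set of quivers on $[n]$ mutation-equivalent to an isomorphic copy of $Q$; $\mathcal M$ is the set of all such classes. Write $[P]\preceq[Q]$ if $P$ is isomorphic to a full subquiver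 (restriction to a vertex subset) of $Q$; $\mathcal M$ carries the topology whose open sets are the upward-closed subsets of $(\mathcal M,\preceq)$. $\mathcal M'\subseteq\mathcal M$ is the subspace of classes of quivers with no isolated vertices together with the class of the one-vertex quiver. -}

module Defs where

open import Level using (Level)
open import Data.Nat as ℕ using (ℕ; _≤_; _<_)
open import Data.Integer as ℤ using (ℤ; 0ℤ; _⊔_; -_)
open import Data.Fin using (Fin)
open import Data.List using (List)
open import Data.List.Membership.Propositional using (_∈_)
open import Data.Product using (Σ; _×_; _,_; proj₁; proj₂; ∃)
open import Data.Sum using (_⊎_)
open import Relation.Nullary using (¬_; yes; no)
open import Relation.Binary.Definitions using (DecidableEquality)
open import Relation.Binary.PropositionalEquality using (_≡_; _≢_)
open import Relation.Binary.Construct.Closure.ReflexiveTransitive using (Star)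
open import Function.Bundles using (_↔_; Inverse)
open import Function.Definitions using (Injective)
import Data.Nat.Properties as ℕP
import Data.Fin.Properties as FinP

_iff_ : Set → Set → Set
A iff B = (A → B) × (B → A)

Raw : Set → Set
Raw X = X → X → ℤ

Quiver : Set → Set
Quiver X = Σ (Raw X) (λ Q → ∀ x y → Q x y ≡ - Q y x)

[_]₊ : ℤ → ℤ
[ a ]₊ = a ⊔ 0ℤ

mutate : {X : Set} → DecidableEquality X → X → Raw X → Raw X
mutate _≟_ k Q v w with k ≟ v | k ≟ w
... | yes _ | _     = - Q v w
... | no _  | yes _ = - Q v w
... | no _  | no _  = Q v w ℤ.+ Q v k ℤ.* [ Q k w ]₊ ℤ.+ [ - Q v k ]₊ ℤ.* Q k w

MutStep : {X : Set} → DecidableEquality X → Raw X → Raw X → Set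
MutStep {X} dec Q P = Σ X (λ k → ∀ v w → P v w ≡ mutate dec k Q v w)

MutEq : {X : Set} → DecidableEquality X → Raw X → Raw X → Set
MutEq dec = Star (MutStep dec)

Isolated : {X : Set} → Raw X → X → Set
Isolated {X} Q x = ∀ (y : X) → Q x y ≡ 0ℤ

HasArrow : {X : Set} → Raw X → Set
HasArrow {X} Q = Σ X (λ x → Σ X (λ y → Q x y ≢ 0ℤ))

-- AF and Fin  (vertex set ℕ = {0,1,2,...} in place of {1,2,...})

AF : Set
AF = Quiver ℕ

-- finiteness: Σ |Q(x,y)| < ∞, i.e. only finitely many nonzero entries,
-- i.e. all entries outside [0,N]×[0,N] vanish for some N
IsFinite : AF → Set
IsFinite Q = Σ ℕ (λ N → ∀ x y → (N < x ⊎ N < y) → proj₁ Q x y ≡ 0ℤ)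

FinQ : Set
FinQ = Σ AF IsFinite

raw : FinQ → Raw ℕ
raw Q = proj₁ (proj₁ Q)

AgreeOn : List ℕ → AF → AF → Set
AgreeOn V Q Q' = ∀ x y → x ∈ V → y ∈ V → proj₁ Q' x y ≡ proj₁ Q x y

OpenAF : (AF → Set) → Set
OpenAF O = ∀ Q → O Q → Σ (List ℕ) (λ V → ∀ Q' → AgreeOn V Q Q' → O Q')

OpenFin : (FinQ → Set) → Set₁
OpenFin U = Σ (AF → Set) (λ O → OpenAF O × (∀ (Q : FinQ) → U Q iff O (proj₁ Q)))

IsoAF : Raw ℕ → Raw ℕ → Set
IsoAF Q Q' = Σ (ℕ ↔ ℕ) (λ σ → ∀ x y → Q' (Inverse.to σ x) (Inverse.to σ y) ≡ Q x y)

data _∼_ : FinQ → FinQ → Set where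
  ∼-mut   : ∀ {Q Q'} → MutStep ℕP._≟_ (raw Q) (raw Q') → Q ∼ Q'
  ∼-iso   : ∀ {Q Q'} → IsoAF (raw Q) (raw Q') → Q ∼ Q'
  ∼-refl  : ∀ {Q} → Q ∼ Q
  ∼-sym   : ∀ {Q Q'} → Q ∼ Q' → Q' ∼ Q
  ∼-trans : ∀ {Q Q' Q''} → Q ∼ Q' → Q' ∼ Q'' → Q ∼ Q''

-- subsets of Fin/∼ are ∼-saturated subsets of Fin; open iff preimage open
Saturated : (FinQ → Set) → Set
Saturated U = ∀ Q Q' → Q ∼ Q' → U Q → U Q'

record MQ : Set where
  constructor mq
  field
    n   : ℕ
    pos : 1 ≤ n
    q   : Quiver (Fin n)
open MQ public

qr : (A : MQ) → Raw (Fin (n A))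
qr A = proj₁ (q A)

-- A ≈M B : B is mutation-equivalent to an isomorphic copy of A  ([A] = [B])
_≈M_ : MQ → MQ → Set
A ≈M B = Σ (Fin (n A) ↔ Fin (n B)) (λ σ →
           MutEq FinP._≟_ (λ u v → qr A (Inverse.from σ u) (Inverse.from σ v)) (qr B))

_⊑_ : MQ → MQ → Set
A ⊑ B = Σ (Fin (n A) → Fin (n B)) (λ ι → Injective _≡_ _≡_ ι × (∀ x y → qr A x y ≡ qr B (ι x) (ι y)))

_⪯_ : MQ → MQ → Set
A ⪯ B = Σ MQ (λ A' → Σ MQ (λ B' → A ≈M A' × B ≈M B' × A' ⊑ B'))

-- open subsets of 𝓜 : upward closed
UpClosed : (MQ → Set) → Set
UpClosed W = ∀ A B → W A → A ⪯ B → W B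

oneVertex : MQ
oneVertex = mq 1 ℕP.≤-refl ((λ _ _ → 0ℤ) , (λ _ _ → Relation.Binary.PropositionalEquality.refl))

NoIsolated : MQ → Set
NoIsolated A = ∀ x → ¬ Isolated (qr A) x

InM' : MQ → Set
InM' A = Σ MQ (λ B → A ≈M B × NoIsolated B) ⊎ (A ≈M oneVertex)

-- The map f: Rep Q A  means  A is a quiver on [n] isomorphic to Q'
-- (Q with isolated vertices removed if Q has an arrow; the one-vertex quiver otherwise)

Rep : FinQ → MQ → Set
Rep Q A =
  (HasArrow (raw Q) ×
     Σ (Fin (n A) → ℕ) (λ e →
         Injective _≡_ _≡_ e
       × (∀ v → (¬ Isolated (raw Q) v) iff Σ (Fin (n A)) (λ x → e x ≡ v))
       × (∀ x y → qr A x y ≡ raw Q (e x) (e y))))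
  ⊎ ((∀ x y → raw Q x y ≡ 0ℤ) × A ≈M oneVertex)

{-# OPTIONS --safe #-}
-- A support of a finite quiver Q on ℕ is a quiver C on [m] with an injective labelling
-- e : [m] → ℕ such that C is the full subquiver of Q on the image of e and this image contains
-- every non-isolated vertex of Q. The value of f at Q is a support without isolated vertices
-- (the one-vertex quiver if Q has no arrows); such exact supports are unique up to isomorphism,
-- and a mutation of Q either fixes Q or mutates its exact support, so f is well defined.
-- Conversely a mutation of any support lifts to a mutation of Q, and two quivers on ℕ with the
-- same support differ by a permutation of ℕ, so f is injective. All arrows of Q₀ lie in a finite
-- window, and every Q agreeing with Q₀ there has f Q₀ as a full subquiver of f Q: f is
-- continuous. For openness, the classes having a support in some Q ∈ U are closed under
-- mutation (U is saturated) and under passing to a larger quiver D ⊒ C, because Q can be changed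
-- away from any finite window so that D becomes a support.

module Submission where

open import Defs
open import Data.Empty using (⊥-elim)
open import Data.Fin as Fin using (Fin; zero; suc; toℕ)
import Data.Fin.Properties as FinP
open import Data.Integer as ℤ using (ℤ; 0ℤ; -_; +_; -[1+_])
import Data.Integer.Properties as ℤP
open import Data.Integer.Tactic.RingSolver using (solve-∀)
open import Data.Nat as ℕ using (ℕ)
import Data.Nat.Properties as ℕP
open import Data.List as List using (List; _∷_; upTo; filter)
open import Data.List.Membership.Propositional using (_∈_)
open import Data.List.Extrema.Nat using (max; xs≤max)
open import Data.List.Membership.Propositional.Properties
  using (∈-lookup; ∈-filter⁺; ∈-filter⁻; ∈-upTo⁺; ∈-tabulate⁺)
import Data.List.Relation.Unary.All as All
import Data.List.Relation.Unary.Any as Any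
open import Data.List.Relation.Unary.Any.Properties using (lookup-index)
open import Data.List.Relation.Unary.Unique.Propositional using (Unique; _∷_)
open import Data.List.Relation.Unary.Unique.Propositional.Properties using (filter⁺; upTo⁺)
open import Data.Product using (Σ; _×_; _,_; proj₁; proj₂)
open import Data.Sum using (_⊎_; inj₁; inj₂)
open import Function using (_∘_)
open import Function.Bundles using (_↔_; Inverse; Injection; mk↔ₛ′)
open import Function.Construct.Composition using (_↔-∘_)
open import Function.Construct.Identity using (↔-id)
open import Function.Construct.Symmetry using (↔-sym)
open import Function.Definitions using (Injective)
open import Function.Properties.Inverse using (↔⇒↣)
open import Relation.Binary.Construct.Closure.ReflexiveTransitive using (ε; _◅_; _◅◅_; gmap)
open import Relation.Binary.Definitions using (DecidableEquality)
open import Relation.Binary.PropositionalEquality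
open import Relation.Nullary using (¬_; yes; no; Dec)
open import Relation.Nullary.Decidable using (map′; decidable-stable; ¬?)

-- Mutation of skew-symmetric integer matrices

mutated : ℤ → ℤ → ℤ → ℤ
mutated c a b = c ℤ.+ a ℤ.* [ b ]₊ ℤ.+ [ - a ]₊ ℤ.* b

module _ where
  open import Data.Integer using (_+_; _*_)

  [i]₊≡i+[-i]₊ : ∀ i → [ i ]₊ ≡ i + [ - i ]₊
  [i]₊≡i+[-i]₊ (+ ℕ.zero)  = refl
  [i]₊≡i+[-i]₊ (+ ℕ.suc n) = sym (ℤP.+-identityʳ _)
  [i]₊≡i+[-i]₊ -[1+ n ]    = sym (ℤP.+-inverseʳ -[1+ n ])

  mutated-zeroˡ : ∀ c b → mutated c 0ℤ b ≡ c
  mutated-zeroˡ c b = trans (ℤP.+-identityʳ _) (ℤP.+-identityʳ c)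

  mutated-zeroʳ : ∀ c a → mutated c a 0ℤ ≡ c
  mutated-zeroʳ c a = begin
    c + a * 0ℤ + [ - a ]₊ * 0ℤ ≡⟨ cong₂ (λ s t → c + s + t) (ℤP.*-zeroʳ a) (ℤP.*-zeroʳ [ - a ]₊) ⟩
    c + 0ℤ + 0ℤ                ≡⟨ trans (ℤP.+-identityʳ _) (ℤP.+-identityʳ c) ⟩
    c                          ∎
    where open ≡-Reasoning

  mutated-antisym : ∀ c a b → mutated (- c) (- b) (- a) ≡ - mutated c a b
  mutated-antisym c a b = begin
    - c + - b * [ - a ]₊ + [ - - b ]₊ * - a
      ≡⟨ cong (λ t → - c + - b * [ - a ]₊ + [ t ]₊ * - a) (ℤP.neg-involutive b) ⟩
    - c + - b * [ - a ]₊ + [ b ]₊ * - a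
      ≡⟨ identity c a b [ - a ]₊ [ b ]₊ ⟩
    - mutated c a b ∎
    where
    open ≡-Reasoning
    identity : ∀ c a b p q → - c + - b * p + q * - a ≡ - (c + a * q + p * b)
    identity = solve-∀

  mutated-involutive : ∀ c a b → mutated (mutated c a b) (- a) (- b) ≡ c
  mutated-involutive c a b = begin
    mutated c a b + - a * [ - b ]₊ + [ - - a ]₊ * - b
      ≡⟨ cong₂ (λ s t → c + a * s + [ - a ]₊ * b + - a * [ - b ]₊ + t * - b)
           ([i]₊≡i+[-i]₊ b) (trans (cong [_]₊ (ℤP.neg-involutive a)) ([i]₊≡i+[-i]₊ a)) ⟩
    c + a * (b + [ - b ]₊) + [ - a ]₊ * b + - a * [ - b ]₊ + (a + [ - a ]₊) * - b
      ≡⟨ identity c a b [ - a ]₊ [ - b ]₊ ⟩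
    c ∎
    where
    open ≡-Reasoning
    identity : ∀ c a b p r → c + a * (b + r) + p * b + - a * r + (a + p) * - b ≡ c
    identity = solve-∀

_≐_ : {X : Set} → Raw X → Raw X → Set
P ≐ Q = ∀ v w → P v w ≡ Q v w

Skew : {X : Set} → Raw X → Set
Skew Q = ∀ x y → Q x y ≡ - Q y x

pull : {X Y : Set} → (Y → X) → Raw X → Raw Y
pull f Q a b = Q (f a) (f b)

NoArrows : {X : Set} → Raw X → Set
NoArrows {X} Q = ∀ (u : X) → Isolated Q u

i≡-i⇒i≡0 : ∀ {i} → i ≡ - i → i ≡ 0ℤ
i≡-i⇒i≡0 {+ ℕ.zero} _ = refl

skew-diagonal : {X : Set} {Q : Raw X} → Skew Q → ∀ x → Q x x ≡ 0ℤ
skew-diagonal sk x = i≡-i⇒i≡0 (sk x x)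

skew-isolated : {X : Set} {Q : Raw X} → Skew Q → ∀ {u} → Isolated Q u → ∀ v → Q v u ≡ 0ℤ
skew-isolated sk {u} iso v = trans (sk v u) (cong -_ (iso v))

module _ {X : Set} (_≟_ : DecidableEquality X) {Q : Raw X} where

  mutate-atˡ : ∀ {k v} w → k ≡ v → mutate _≟_ k Q v w ≡ - Q v w
  mutate-atˡ {k} {v} w k≡v with k ≟ v
  ... | yes _   = refl
  ... | no k≢v  = ⊥-elim (k≢v k≡v)

  mutate-atʳ : ∀ {k} v {w} → k ≡ w → mutate _≟_ k Q v w ≡ - Q v w
  mutate-atʳ {k} v {w} k≡w with k ≟ v | k ≟ w
  ... | yes _ | _      = refl
  ... | no _  | yes _  = refl
  ... | no _  | no k≢w = ⊥-elim (k≢w k≡w)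

  mutate-away : ∀ {k v w} → k ≢ v → k ≢ w → mutate _≟_ k Q v w ≡ mutated (Q v w) (Q v k) (Q k w)
  mutate-away {k} {v} {w} k≢v k≢w with k ≟ v | k ≟ w
  ... | yes k≡v | _       = ⊥-elim (k≢v k≡v)
  ... | no _    | yes k≡w = ⊥-elim (k≢w k≡w)
  ... | no _    | no _    = refl

  mutate-isolated : ∀ k {u} → Isolated Q u → Isolated (mutate _≟_ k Q) u
  mutate-isolated k {u} iso y with k ≟ u | k ≟ y
  ... | yes _ | _     = cong -_ (iso y)
  ... | no _  | yes _ = cong -_ (iso y)
  ... | no _  | no _  = trans (cong₂ (λ c a → mutated c a (Q k y)) (iso y) (iso k))
                              (mutated-zeroˡ 0ℤ (Q k y))

  module _ (sk : Skew Q) where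

    mutate-skew : ∀ k → Skew (mutate _≟_ k Q)
    mutate-skew k v w with k ≟ v | k ≟ w
    ... | yes _ | yes _ = cong -_ (sk v w)
    ... | yes _ | no _  = cong -_ (sk v w)
    ... | no _  | yes _ = cong -_ (sk v w)
    ... | no _  | no _  = sym (begin
      - mutated (Q w v) (Q w k) (Q k v)       ≡⟨ cong (λ c → - mutated c (Q w k) (Q k v)) (sk w v) ⟩
      - mutated (- Q v w) (Q w k) (Q k v)     ≡⟨ cong₂ (λ a b → - mutated (- Q v w) a b) (sk w k) (sk k v) ⟩
      - mutated (- Q v w) (- Q k w) (- Q v k) ≡⟨ cong -_ (mutated-antisym (Q v w) (Q v k) (Q k w)) ⟩
      - - mutated (Q v w) (Q v k) (Q k w)     ≡⟨ ℤP.neg-involutive _ ⟩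
      mutated (Q v w) (Q v k) (Q k w)         ∎)
      where open ≡-Reasoning

    mutate-at-isolated : ∀ {k} → Isolated Q k → mutate _≟_ k Q ≐ Q
    mutate-at-isolated {k} iso v w with k ≟ v | k ≟ w
    ... | yes refl | _        = trans (cong -_ (iso w)) (sym (iso w))
    ... | no _     | yes refl = trans (cong -_ (skew-isolated sk iso v)) (sym (skew-isolated sk iso v))
    ... | no _     | no _     = trans (cong (mutated (Q v w) (Q v k)) (iso w))
                                      (mutated-zeroʳ (Q v w) (Q v k))

    mutate-involutive : ∀ k → mutate _≟_ k (mutate _≟_ k Q) ≐ Q
    mutate-involutive k v w with k ≟ v | k ≟ w
    ... | yes k≡v | _       = trans (cong -_ (mutate-atˡ w k≡v)) (ℤP.neg-involutive (Q v w))
    ... | no _    | yes k≡w = trans (cong -_ (mutate-atʳ v k≡w)) (ℤP.neg-involutive (Q v w))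
    ... | no k≢v  | no k≢w  = begin
      mutated (mutate _≟_ k Q v w) (mutate _≟_ k Q v k) (mutate _≟_ k Q k w)
        ≡⟨ cong₂ (λ c a → mutated c a (mutate _≟_ k Q k w))
                 (mutate-away k≢v k≢w) (mutate-atʳ v refl) ⟩
      mutated (mutated (Q v w) (Q v k) (Q k w)) (- Q v k) (mutate _≟_ k Q k w)
        ≡⟨ cong (mutated (mutated (Q v w) (Q v k) (Q k w)) (- Q v k)) (mutate-atˡ {k} w refl) ⟩
      mutated (mutated (Q v w) (Q v k) (Q k w)) (- Q v k) (- Q k w)
        ≡⟨ mutated-involutive (Q v w) (Q v k) (Q k w) ⟩
      Q v w ∎
      where open ≡-Reasoning

module _ {X : Set} (_≟_ : DecidableEquality X) where

  mutate-cong : ∀ {P Q : Raw X} k → P ≐ Q → mutate _≟_ k P ≐ mutate _≟_ k Q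
  mutate-cong {P} {Q} k P≐Q v w with k ≟ v | k ≟ w
  ... | yes _ | _     = cong -_ (P≐Q v w)
  ... | no _  | yes _ = cong -_ (P≐Q v w)
  ... | no _  | no _  = trans (cong₂ (λ c a → mutated c a (P k w)) (P≐Q v w) (P≐Q v k))
                              (cong (mutated (Q v w) (Q v k)) (P≐Q k w))

  mutate-isolated⁻ : ∀ {Q : Raw X} → Skew Q → ∀ k {u} → Isolated (mutate _≟_ k Q) u → Isolated Q u
  mutate-isolated⁻ sk k {u} iso y =
    trans (sym (mutate-involutive _≟_ sk k u y)) (mutate-isolated _≟_ k iso y)


  MutStep-skew : ∀ {Q P : Raw X} → Skew Q → MutStep _≟_ Q P → Skew P
  MutStep-skew sk (k , P≐μQ) x y =
    trans (P≐μQ x y) (trans (mutate-skew _≟_ sk k x y) (cong -_ (sym (P≐μQ y x))))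

  MutStep-reverse : ∀ {Q P : Raw X} → Skew Q → MutStep _≟_ Q P → MutStep _≟_ P Q
  MutStep-reverse sk (k , P≐μQ) =
    k , λ v w → sym (trans (mutate-cong k P≐μQ v w) (mutate-involutive _≟_ sk k v w))

  NoArrows-MutStep : ∀ {Q P : Raw X} → MutStep _≟_ Q P → NoArrows Q → NoArrows P
  NoArrows-MutStep (k , P≐μQ) none u y = trans (P≐μQ u y) (mutate-isolated _≟_ k (none u) y)

  MutEq-reverse : ∀ {Q P : Raw X} → Skew Q → MutEq _≟_ Q P → MutEq _≟_ P Q
  MutEq-reverse sk ε        = ε
  MutEq-reverse sk (s ◅ ss) = MutEq-reverse (MutStep-skew sk s) ss ◅◅ (MutStep-reverse sk s ◅ ε)

  -- ε only relates a function to itself; a double mutation at any vertex relates pointwise equal quivers.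
  ≐⇒MutEq : X → ∀ {Q P : Raw X} → Skew Q → Q ≐ P → MutEq _≟_ Q P
  ≐⇒MutEq k sk Q≐P =
    (k , λ _ _ → refl) ◅
    (k , λ v w → trans (sym (Q≐P v w)) (sym (mutate-involutive _≟_ sk k v w))) ◅ ε

module _ {X Y : Set} (_≟X_ : DecidableEquality X) (_≟Y_ : DecidableEquality Y)
         {f : Y → X} (f-injective : Injective _≡_ _≡_ f) (Q : Raw X) where

  mutate-pull : ∀ k v w → mutate _≟X_ (f k) Q (f v) (f w) ≡ mutate _≟Y_ k (pull f Q) v w
  mutate-pull k v w with k ≟Y v | k ≟Y w
  ... | yes k≡v | _       = mutate-atˡ _≟X_ (f w) (cong f k≡v)
  ... | no _    | yes k≡w = mutate-atʳ _≟X_ (f v) (cong f k≡w)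
  ... | no k≢v  | no k≢w  = mutate-away _≟X_ (k≢v ∘ f-injective) (k≢w ∘ f-injective)

module _ {A B : Set} (σ : A ↔ B) where
  open Inverse σ

  to-injective : Injective _≡_ _≡_ to
  to-injective = Injection.injective (↔⇒↣ σ)

module _ {X Y : Set} (_≟X_ : DecidableEquality X) (_≟Y_ : DecidableEquality Y) (σ : Y ↔ X) where
  open Inverse σ

  MutEq-pull : ∀ {Q P : Raw X} → MutEq _≟X_ Q P → MutEq _≟Y_ (pull to Q) (pull to P)
  MutEq-pull = gmap (pull to) step
    where
    step : ∀ {Q P : Raw X} → MutStep _≟X_ Q P → MutStep _≟Y_ (pull to Q) (pull to P)
    step {Q} {P} (k , P≐μQ) = from k , λ a b → begin
      P (to a) (to b)                           ≡⟨ P≐μQ (to a) (to b) ⟩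
      mutate _≟X_ k Q (to a) (to b)             ≡⟨ cong (λ k' → mutate _≟X_ k' Q (to a) (to b))
                                                        (sym (strictlyInverseˡ k)) ⟩
      mutate _≟X_ (to (from k)) Q (to a) (to b) ≡⟨ mutate-pull _≟X_ _≟Y_ (to-injective σ) Q (from k) a b ⟩
      mutate _≟Y_ (from k) (pull to Q) a b      ∎
      where open ≡-Reasoning

-- Injective labellings by ℕ

transpose : ℕ → ℕ → ℕ → ℕ
transpose i j k with k ℕP.≟ i
... | yes _ = j
... | no _ with k ℕP.≟ j
...   | yes _ = i
...   | no _  = k

transpose-left : ∀ i j → transpose i j i ≡ j
transpose-left i j with i ℕP.≟ i
... | yes _  = refl
... | no i≢i = ⊥-elim (i≢i refl)

transpose-fixed : ∀ {i j k} → k ≢ i → k ≢ j → transpose i j k ≡ k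
transpose-fixed {i} {j} {k} k≢i k≢j with k ℕP.≟ i
... | yes k≡i = ⊥-elim (k≢i k≡i)
... | no _ with k ℕP.≟ j
...   | yes k≡j = ⊥-elim (k≢j k≡j)
...   | no _    = refl

transpose-involutive : ∀ i j k → transpose i j (transpose i j k) ≡ k
transpose-involutive i j k with k ℕP.≟ i
... | yes refl = transpose-right
  where
  transpose-right : transpose k j j ≡ k
  transpose-right with j ℕP.≟ k
  ... | yes j≡k = j≡k
  ... | no _ with j ℕP.≟ j
  ...   | yes _  = refl
  ...   | no j≢j = ⊥-elim (j≢j refl)
... | no k≢i with k ℕP.≟ j
...   | yes refl = transpose-left i k
...   | no k≢j   = transpose-fixed k≢i k≢j

transpose↔ : ℕ → ℕ → ℕ ↔ ℕ
transpose↔ i j =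
  mk↔ₛ′ (transpose i j) (transpose i j) (transpose-involutive i j) (transpose-involutive i j)

-- The offset k lets the induction place e ∘ suc from k + 1 on and then swap the image of e zero with k.
relabel-from : ∀ {m} (e : Fin m → ℕ) → Injective _≡_ _≡_ e → ∀ k →
               Σ (ℕ ↔ ℕ) (λ π → ∀ x → Inverse.to π (e x) ≡ k ℕ.+ toℕ x)
relabel-from {ℕ.zero} e _ k = ↔-id _ , λ ()
relabel-from {ℕ.suc m} e e-injective k = transpose↔ p k ↔-∘ π , placed
  where
  rest : Σ (ℕ ↔ ℕ) (λ π → ∀ x → Inverse.to π (e (suc x)) ≡ ℕ.suc k ℕ.+ toℕ x)
  rest = relabel-from (e ∘ suc) (λ eq → FinP.suc-injective (e-injective eq)) (ℕ.suc k)
  π : ℕ ↔ ℕ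
  π = proj₁ rest
  p : ℕ
  p = Inverse.to π (e zero)
  p-fresh : ∀ x → ℕ.suc k ℕ.+ toℕ x ≢ p
  p-fresh x eq with e-injective (to-injective π (trans (proj₂ rest x) eq))
  ... | ()
  placed : ∀ x → transpose p k (Inverse.to π (e x)) ≡ k ℕ.+ toℕ x
  placed zero    = trans (transpose-left p k) (sym (ℕP.+-identityʳ k))
  placed (suc x) = begin
    transpose p k (Inverse.to π (e (suc x))) ≡⟨ cong (transpose p k) (proj₂ rest x) ⟩
    transpose p k (ℕ.suc k ℕ.+ toℕ x)        ≡⟨ transpose-fixed (p-fresh x) (ℕP.>⇒≢ (ℕP.m≤m+n _ _)) ⟩
    ℕ.suc k ℕ.+ toℕ x                        ≡⟨ sym (ℕP.+-suc k (toℕ x)) ⟩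
    k ℕ.+ toℕ (suc x)                        ∎
    where open ≡-Reasoning

relabel : ∀ {m} {e e' : Fin m → ℕ} → Injective _≡_ _≡_ e → Injective _≡_ _≡_ e' →
          Σ (ℕ ↔ ℕ) (λ π → ∀ x → Inverse.to π (e x) ≡ e' x)
relabel {e = e} {e'} e-injective e'-injective = ↔-sym π' ↔-∘ π , λ x → begin
    Inverse.from π' (Inverse.to π (e x))   ≡⟨ cong (Inverse.from π') (trans (placed x) (sym (placed' x))) ⟩
    Inverse.from π' (Inverse.to π' (e' x)) ≡⟨ Inverse.strictlyInverseʳ π' (e' x) ⟩
    e' x                                   ∎
  where
  open ≡-Reasoning
  π π' : ℕ ↔ ℕ
  π = proj₁ (relabel-from e e-injective 0)
  π' = proj₁ (relabel-from e' e'-injective 0)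
  placed : ∀ x → Inverse.to π (e x) ≡ toℕ x
  placed = proj₂ (relabel-from e e-injective 0)
  placed' : ∀ x → Inverse.to π' (e' x) ≡ toℕ x
  placed' = proj₂ (relabel-from e' e'-injective 0)

lookup-injective : ∀ {xs : List ℕ} → Unique xs → Injective _≡_ _≡_ (List.lookup xs)
lookup-injective {_ ∷ _} (_    ∷ _) {zero}  {zero}  _  = refl
lookup-injective {_ ∷ _} (x∉xs ∷ _) {zero}  {suc j} eq = ⊥-elim (All.lookup x∉xs (∈-lookup j) eq)
lookup-injective {_ ∷ _} (x∉xs ∷ _) {suc i} {zero}  eq = ⊥-elim (All.lookup x∉xs (∈-lookup i) (sym eq))
lookup-injective {_ ∷ _} (_    ∷ u) {suc i} {suc j} eq = cong suc (lookup-injective u eq)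

skewMQ : (A : MQ) → Skew (qr A)
skewMQ A = proj₂ (q A)

vertex : (A : MQ) → Fin (n A)
vertex (mq (ℕ.suc _) _ _) = zero

mutateMQ : (A : MQ) → Fin (n A) → MQ
mutateMQ A k = mq (n A) (pos A) (mutate FinP._≟_ k (qr A) , mutate-skew FinP._≟_ (skewMQ A) k)

≈M-refl : ∀ {A} → A ≈M A
≈M-refl = ↔-id _ , ε

≈M-mutate : ∀ A k → A ≈M mutateMQ A k
≈M-mutate A k = ↔-id _ , (k , λ _ _ → refl) ◅ ε

≈M-≐ : ∀ {A B} (σ : Fin (n A) ↔ Fin (n B)) → pull (Inverse.from σ) (qr A) ≐ qr B → A ≈M B
≈M-≐ {A} {B} σ A≐B = σ , ≐⇒MutEq FinP._≟_ (vertex B) (λ u v → skewMQ A _ _) A≐B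

≈M-sym : ∀ {A B} → A ≈M B → B ≈M A
≈M-sym {A} {B} (σ , c) = ↔-sym σ ,
  MutEq-pull FinP._≟_ FinP._≟_ σ (MutEq-reverse FinP._≟_ (λ u v → skewMQ A _ _) c)
  ◅◅ ≐⇒MutEq FinP._≟_ (vertex A) (λ u v → skewMQ A _ _)
       (λ u v → cong₂ (qr A) (Inverse.strictlyInverseʳ σ u) (Inverse.strictlyInverseʳ σ v))

≈M-trans : ∀ {A B C} → A ≈M B → B ≈M C → A ≈M C
≈M-trans (σ , c) (τ , d) = τ ↔-∘ σ , MutEq-pull FinP._≟_ FinP._≟_ (↔-sym τ) c ◅◅ d

-- Finite quivers on ℕ and their supports

skewFin : (Q : FinQ) → Skew (raw Q)
skewFin Q = proj₂ (proj₁ Q)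

bound : FinQ → ℕ
bound Q = proj₁ (proj₂ Q)

isolated-beyond-bound : (Q : FinQ) → ∀ {u} → bound Q ℕ.< u → Isolated (raw Q) u
isolated-beyond-bound Q lt y = proj₂ (proj₂ Q) _ y (inj₁ lt)

nonIsolated⇒≤bound : (Q : FinQ) → ∀ {u} → ¬ Isolated (raw Q) u → u ℕ.≤ bound Q
nonIsolated⇒≤bound Q {u} ni with u ℕ.≤? bound Q
... | yes u≤b = u≤b
... | no u≰b  = ⊥-elim (ni (isolated-beyond-bound Q (ℕP.≰⇒> u≰b)))

window : FinQ → List ℕ
window Q = upTo (ℕ.suc (bound Q))

nonIsolated∈window : (Q : FinQ) → ∀ {u} → ¬ Isolated (raw Q) u → u ∈ window Q
nonIsolated∈window Q ni = ∈-upTo⁺ (ℕ.s≤s (nonIsolated⇒≤bound Q ni))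

isolated? : (Q : FinQ) → ∀ u → Dec (Isolated (raw Q) u)
isolated? Q u =
  map′ below⇒all (λ iso y → iso (toℕ y)) (FinP.all? (λ y → raw Q u (toℕ y) ℤ.≟ 0ℤ))
  where
  below⇒all : (∀ (y : Fin (ℕ.suc (bound Q))) → raw Q u (toℕ y) ≡ 0ℤ) → Isolated (raw Q) u
  below⇒all h y with y ℕ.≤? bound Q
  ... | yes y≤b = subst (λ t → raw Q u t ≡ 0ℤ) (FinP.toℕ-fromℕ< (ℕ.s≤s y≤b))
                        (h (Fin.fromℕ< (ℕ.s≤s y≤b)))
  ... | no y≰b  = proj₂ (proj₂ Q) u y (inj₂ (ℕP.≰⇒> y≰b))

mutateFin : FinQ → ℕ → FinQ
mutateFin Q k = (mutate ℕP._≟_ k (raw Q) , mutate-skew ℕP._≟_ (skewFin Q) k) , bound Q , vanishes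
  where
  vanishes : ∀ x y → bound Q ℕ.< x ⊎ bound Q ℕ.< y → mutate ℕP._≟_ k (raw Q) x y ≡ 0ℤ
  vanishes x y (inj₁ lt) = mutate-isolated ℕP._≟_ k (isolated-beyond-bound Q lt) y
  vanishes x y (inj₂ lt) = skew-isolated (mutate-skew ℕP._≟_ (skewFin Q) k)
                             (mutate-isolated ℕP._≟_ k (isolated-beyond-bound Q lt)) x

Image : ∀ {m} → (Fin m → ℕ) → ℕ → Set
Image {m} e u = Σ (Fin m) (λ x → e x ≡ u)

image? : ∀ {m} (e : Fin m → ℕ) u → Dec (Image e u)
image? e u = FinP.any? (λ x → e x ℕP.≟ u)

record SupportEmbedding (Q : FinQ) {m} (C : Raw (Fin m)) (e : Fin m → ℕ) : Set where
  field
    injective : Injective _≡_ _≡_ e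
    covers    : ∀ {u} → ¬ Isolated (raw Q) u → Image e u
    restricts : C ≐ pull e (raw Q)
open SupportEmbedding

Support : FinQ → MQ → Set
Support Q A = Σ (Fin (n A) → ℕ) (SupportEmbedding Q (qr A))

module _ {Q : FinQ} {m} {C : Raw (Fin m)} {e : Fin m → ℕ} (S : SupportEmbedding Q C e) where

  outside-isolated : ∀ {u} → ¬ Image e u → Isolated (raw Q) u
  outside-isolated ∉e y =
    decidable-stable (raw Q _ y ℤ.≟ 0ℤ) (λ Quy≢0 → ∉e (covers S (λ iso → Quy≢0 (iso y))))

  noIsolated⇒exact : (∀ x → ¬ Isolated C x) → ∀ x → ¬ Isolated (raw Q) (e x)
  noIsolated⇒exact noIso x iso = noIso x (λ y → trans (restricts S x y) (iso (e y)))

  exact⇒noIsolated : (∀ x → ¬ Isolated (raw Q) (e x)) → ∀ x → ¬ Isolated C x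
  exact⇒noIsolated exact x iso = exact x isolated
    where
    isolated : Isolated (raw Q) (e x)
    isolated v with image? e v
    ... | yes (y , refl) = trans (sym (restricts S x y)) (iso y)
    ... | no ∉e          = skew-isolated (skewFin Q) (outside-isolated ∉e) (e x)

Fin1-unique : (x y : Fin 1) → x ≡ y
Fin1-unique zero zero = refl

nonIsolated⇒neighbour : ∀ {m} (C : Raw (Fin m)) {x} → ¬ Isolated C x → Σ (Fin m) (λ y → C x y ≢ 0ℤ)
nonIsolated⇒neighbour {m} C {x} = FinP.¬∀⟶∃¬ m _ (λ y → C x y ℤ.≟ 0ℤ)

RepArrows : FinQ → MQ → Set
RepArrows Q A = HasArrow (raw Q) ×
  Σ (Fin (n A) → ℕ) (λ e → Injective _≡_ _≡_ e
                          × (∀ v → (¬ Isolated (raw Q) v) iff Image e v)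
                          × (qr A ≐ pull e (raw Q)))

arrows⇒support : ∀ {Q A} → RepArrows Q A → Support Q A × NoIsolated A
arrows⇒support {Q} {A} (_ , e , inj , iff , agree) =
  (e , S) , exact⇒noIsolated S (λ x → proj₂ (iff (e x)) (x , refl))
  where
  S : SupportEmbedding Q (qr A) e
  S = record { injective = inj ; covers = proj₁ (iff _) ; restricts = agree }

support⇒Rep : ∀ {Q A} → Support Q A → NoIsolated A → Rep Q A
support⇒Rep {Q} {A} (e , S) noIso =
  inj₁ (arrow , e , injective S , (λ v → covers S , λ { (x , refl) → exact x }) , restricts S)
  where
  exact : ∀ x → ¬ Isolated (raw Q) (e x)
  exact = noIsolated⇒exact S noIso
  arrow : HasArrow (raw Q)
  arrow = let (y , Axy≢0) = nonIsolated⇒neighbour (qr A) (noIso (vertex A))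
          in e (vertex A) , e y , Axy≢0 ∘ trans (restricts S _ _)

NoArrows⇒Rep : ∀ {Q} → NoArrows (raw Q) → Rep Q oneVertex
NoArrows⇒Rep none = inj₂ (none , ≈M-refl {oneVertex})

Rep-support : ∀ {Q A} → Rep Q A → Σ MQ (λ C → A ≈M C × Support Q C)
Rep-support {Q} {A} (inj₁ r) = A , ≈M-refl {A} , proj₁ (arrows⇒support {Q} {A} r)
Rep-support (inj₂ (none , A≈1)) = oneVertex , A≈1 , (λ _ → 0) , record
  { injective = λ {x} {y} _ → Fin1-unique x y
  ; covers    = λ ni → ⊥-elim (ni (none _))
  ; restricts = λ _ _ → sym (none 0 0)
  }

support-Fin1⇒NoArrows : ∀ {Q} {C : Raw (Fin 1)} {e} → SupportEmbedding Q C e → NoArrows (raw Q)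
support-Fin1⇒NoArrows {Q} {e = e} S u y = decidable-stable (raw Q u y ℤ.≟ 0ℤ) λ Quy≢0 →
  let (x , ex≡u) = covers S (λ iso → Quy≢0 (iso y))
      (x' , ex'≡y) = covers S (λ iso → Quy≢0 (skew-isolated (skewFin Q) iso u))
      u≡y = trans (sym ex≡u) (trans (cong e (Fin1-unique x x')) ex'≡y)
  in Quy≢0 (subst (λ t → raw Q u t ≡ 0ℤ) u≡y (skew-diagonal (skewFin Q) u))

support-unique : ∀ {Q C D} → Support Q C → NoIsolated C → Support Q D → NoIsolated D → C ≈M D
support-unique {Q} {C} {D} (e , S) noIsoC (e' , S') noIsoD = ≈M-≐ {C} {D} σ C≐D
  where
  to : Fin (n C) → Fin (n D)
  to x = proj₁ (covers S' (noIsolated⇒exact S noIsoC x))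
  from : Fin (n D) → Fin (n C)
  from y = proj₁ (covers S (noIsolated⇒exact S' noIsoD y))
  e'∘to : ∀ x → e' (to x) ≡ e x
  e'∘to x = proj₂ (covers S' (noIsolated⇒exact S noIsoC x))
  e∘from : ∀ y → e (from y) ≡ e' y
  e∘from y = proj₂ (covers S (noIsolated⇒exact S' noIsoD y))
  σ : Fin (n C) ↔ Fin (n D)
  σ = mk↔ₛ′ to from (λ y → injective S' (trans (e'∘to (from y)) (e∘from y)))
                    (λ x → injective S (trans (e∘from (to x)) (e'∘to x)))
  C≐D : pull from (qr C) ≐ qr D
  C≐D u v = begin
    qr C (from u) (from v)          ≡⟨ restricts S (from u) (from v) ⟩
    raw Q (e (from u)) (e (from v)) ≡⟨ cong₂ (raw Q) (e∘from u) (e∘from v) ⟩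
    raw Q (e' u) (e' v)             ≡⟨ sym (restricts S' u v) ⟩
    qr D u v                        ∎
    where open ≡-Reasoning

module _ {Q : FinQ} {m} {C : Raw (Fin m)} {e : Fin m → ℕ} (S : SupportEmbedding Q C e) where

  support-iso : ∀ {Q'} ((π , π-iso) : IsoAF (raw Q) (raw Q')) → SupportEmbedding Q' C (Inverse.to π ∘ e)
  support-iso {Q'} (π , π-iso) = record
    { injective = injective S ∘ to-injective π
    ; covers    = λ ni → let (x , ex≡u) = covers S (ni ∘ isolated-transport)
                         in x , trans (cong to ex≡u) (strictlyInverseˡ _)
    ; restricts = λ x y → trans (restricts S x y) (sym (π-iso (e x) (e y)))
    }
    where
    open Inverse π
    isolated-transport : ∀ {u} → Isolated (raw Q) (from u) → Isolated (raw Q') u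
    isolated-transport {u} iso y = begin
      raw Q' u y                         ≡⟨ sym (cong₂ (raw Q') (strictlyInverseˡ u) (strictlyInverseˡ y)) ⟩
      raw Q' (to (from u)) (to (from y)) ≡⟨ π-iso (from u) (from y) ⟩
      raw Q (from u) (from y)            ≡⟨ iso (from y) ⟩
      0ℤ                                 ∎
      where open ≡-Reasoning

  support-≐ : ∀ {Q'} → raw Q ≐ raw Q' → SupportEmbedding Q' C e
  support-≐ Q≐Q' = support-iso (↔-id _ , λ x y → sym (Q≐Q' x y))

  support-relabel : ∀ {m'} (σ : Fin m' ↔ Fin m) → SupportEmbedding Q (pull (Inverse.to σ) C) (e ∘ Inverse.to σ)
  support-relabel σ = record
    { injective = to-injective σ ∘ injective S
    ; covers    = λ ni → let (x , ex≡u) = covers S ni in from x , trans (cong e (strictlyInverseˡ x)) ex≡u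
    ; restricts = λ x y → restricts S _ _
    }
    where open Inverse σ

  MutStep-lift : ∀ {R} ((k , _) : MutStep FinP._≟_ C R) → SupportEmbedding (mutateFin Q (e k)) R e
  MutStep-lift {R} (k , R≐μC) = record
    { injective = injective S
    ; covers    = λ ni → covers S (ni ∘ mutate-isolated ℕP._≟_ (e k))
    ; restricts = λ x y → begin
        R x y                                   ≡⟨ R≐μC x y ⟩
        mutate FinP._≟_ k C x y                 ≡⟨ mutate-cong FinP._≟_ k (restricts S) x y ⟩
        mutate FinP._≟_ k (pull e (raw Q)) x y  ≡⟨ sym (mutate-pull ℕP._≟_ FinP._≟_ (injective S) (raw Q) k x y) ⟩
        mutate ℕP._≟_ (e k) (raw Q) (e x) (e y) ∎
    }
    where open ≡-Reasoning

MutEq-lift : ∀ {Q m} {C D : Raw (Fin m)} {e} → SupportEmbedding Q C e → MutEq FinP._≟_ C D →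
                Σ FinQ (λ Q' → Q ∼ Q' × SupportEmbedding Q' D e)
MutEq-lift {Q} S ε = Q , ∼-refl , S
MutEq-lift {Q} {e = e} S (s ◅ ss) =
  let (Q' , ∼Q' , S') = MutEq-lift (MutStep-lift S s) ss
  in Q' , ∼-trans (∼-mut (e (proj₁ s) , λ _ _ → refl)) ∼Q' , S'

support-≈M : ∀ {Q C D} → Support Q C → C ≈M D → Σ FinQ (λ Q' → Q ∼ Q' × Support Q' D)
support-≈M (e , S) (σ , c) =
  let (Q' , ∼Q' , S') = MutEq-lift (support-relabel S (↔-sym σ)) c in Q' , ∼Q' , _ , S'

support-∼ : ∀ {Q Q' m} {C : Raw (Fin m)} {e e'} → SupportEmbedding Q C e → SupportEmbedding Q' C e' → Q ∼ Q'
support-∼ {Q} {Q'} {C = C} {e} {e'} S S' = ∼-iso (π , π-iso)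
  where
  π : ℕ ↔ ℕ
  π = proj₁ (relabel (injective S) (injective S'))
  open Inverse π
  π∘e : ∀ x → to (e x) ≡ e' x
  π∘e = proj₂ (relabel (injective S) (injective S'))
  outside : ∀ {u} → ¬ Image e u → ¬ Image e' (to u)
  outside ∉e (x , e'x≡πu) = ∉e (x , to-injective π (trans (π∘e x) e'x≡πu))
  π-iso : ∀ u v → raw Q' (to u) (to v) ≡ raw Q u v
  π-iso u v with image? e u | image? e v
  ... | yes (x , refl) | yes (y , refl) = begin
    raw Q' (to (e x)) (to (e y)) ≡⟨ cong₂ (raw Q') (π∘e x) (π∘e y) ⟩
    raw Q' (e' x) (e' y)         ≡⟨ sym (restricts S' x y) ⟩
    C x y                        ≡⟨ restricts S x y ⟩
    raw Q (e x) (e y)            ∎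
    where open ≡-Reasoning
  ... | no ∉e | _ = trans (outside-isolated S' (outside ∉e) (to v)) (sym (outside-isolated S ∉e v))
  ... | yes _ | no ∉e = trans (skew-isolated (skewFin Q') (outside-isolated S' (outside ∉e)) (to u))
                              (sym (skew-isolated (skewFin Q) (outside-isolated S ∉e) u))

support-MutStep : ∀ {Q Q' A} → Support Q A → NoIsolated A → MutStep ℕP._≟_ (raw Q) (raw Q') →
                   Σ MQ (λ C → A ≈M C × Support Q' C × NoIsolated C)
support-MutStep {Q} {Q'} {A} (e , S) noIso (k , Q'≐μQ) with image? e k
... | yes (k₀ , refl) = mutateMQ A k₀ , ≈M-mutate A k₀ ,
        (e , support-≐ (MutStep-lift S (k₀ , λ _ _ → refl)) (λ v w → sym (Q'≐μQ v w))) ,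
        λ x iso → noIso x (mutate-isolated⁻ FinP._≟_ (skewMQ A) k₀ iso)
... | no ∉e = A , ≈M-refl {A} , (e , support-≐ S Q≐Q') , noIso
  where
  Q≐Q' : raw Q ≐ raw Q'
  Q≐Q' v w =
    sym (trans (Q'≐μQ v w) (mutate-at-isolated ℕP._≟_ (skewFin Q) (outside-isolated S ∉e) v w))

push : ∀ {m} → (Fin m → ℕ) → Raw (Fin m) → Raw ℕ
push e C u v with image? e u | image? e v
... | yes (x , _) | yes (y , _) = C x y
... | _           | _           = 0ℤ

module _ {m} {e : Fin m → ℕ} {C : Raw (Fin m)} where

  push-skew : Skew C → Skew (push e C)
  push-skew sk u v with image? e u | image? e v
  ... | yes _ | yes _ = sk _ _
  ... | yes _ | no _  = refl
  ... | no _  | yes _ = refl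
  ... | no _  | no _  = refl

  push-outside : ∀ {u} → ¬ Image e u → Isolated (push e C) u
  push-outside {u} ∉e v with image? e u
  ... | yes ∈e = ⊥-elim (∉e ∈e)
  ... | no _   = refl

  push-image : Injective _≡_ _≡_ e → ∀ x y → push e C (e x) (e y) ≡ C x y
  push-image inj x y with image? e (e x) | image? e (e y)
  ... | yes (_ , ex'≡ex) | yes (_ , ey'≡ey) = cong₂ C (inj ex'≡ex) (inj ey'≡ey)
  ... | no ∉e            | _                = ⊥-elim (∉e (x , refl))
  ... | yes _            | no ∉e            = ⊥-elim (∉e (y , refl))

maxImage : ∀ {m} → (Fin m → ℕ) → ℕ
maxImage e = max 0 (List.tabulate e)

≤maxImage : ∀ {m} (e : Fin m → ℕ) x → e x ℕ.≤ maxImage e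
≤maxImage e x = All.lookup (xs≤max 0 (List.tabulate e)) (∈-tabulate⁺ x)

pushQ : ∀ {m} (e : Fin m → ℕ) (C : Raw (Fin m)) → Skew C → FinQ
pushQ e C sk = (push e C , push-skew sk) , maxImage e , vanishes
  where
  beyond : ∀ {u} → maxImage e ℕ.< u → ¬ Image e u
  beyond lt (x , refl) = ℕP.<⇒≱ lt (≤maxImage e x)
  vanishes : ∀ x y → maxImage e ℕ.< x ⊎ maxImage e ℕ.< y → push e C x y ≡ 0ℤ
  vanishes x y (inj₁ lt) = push-outside (beyond lt) y
  vanishes x y (inj₂ lt) = skew-isolated (push-skew sk) (push-outside (beyond lt)) x

push-support : ∀ {m} {e : Fin m → ℕ} {C} (sk : Skew C) → Injective _≡_ _≡_ e →
               SupportEmbedding (pushQ e C sk) C e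
push-support {e = e} sk inj = record
  { injective = inj
  ; covers    = λ {u} ni → decidable-stable (image? e u) (ni ∘ push-outside)
  ; restricts = λ x y → sym (push-image inj x y)
  }

restrictMQ : (Q : FinQ) {m : ℕ} → (Fin (ℕ.suc m) → ℕ) → MQ
restrictMQ Q {m} e = mq (ℕ.suc m) (ℕ.s≤s ℕ.z≤n) (pull e (raw Q) , λ x y → skewFin Q (e x) (e y))

exact-support⇒Rep : ∀ {Q m} {e : Fin m → ℕ} → SupportEmbedding Q (pull e (raw Q)) e →
                    (∀ x → ¬ Isolated (raw Q) (e x)) → Σ MQ (Rep Q)
exact-support⇒Rep {Q} {ℕ.zero} S _ = oneVertex , NoArrows⇒Rep {Q} (λ u → outside-isolated S λ ())
exact-support⇒Rep {Q} {ℕ.suc m} {e} S exact =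
  restrictMQ Q e , support⇒Rep {Q} {restrictMQ Q e} (e , S) (exact⇒noIsolated S exact)

nonIsolatedVertices : FinQ → List ℕ
nonIsolatedVertices Q = filter (¬? ∘ isolated? Q) (window Q)

Rep-exists : ∀ Q → Σ MQ (Rep Q)
Rep-exists Q = exact-support⇒Rep S exact
  where
  L : List ℕ
  L = nonIsolatedVertices Q
  S : SupportEmbedding Q (pull (List.lookup L) (raw Q)) (List.lookup L)
  S = record
    { injective = lookup-injective (filter⁺ (¬? ∘ isolated? Q) (upTo⁺ (ℕ.suc (bound Q))))
    ; covers    = λ ni → let u∈L = ∈-filter⁺ (¬? ∘ isolated? Q) (nonIsolated∈window Q ni) ni
                         in Any.index u∈L , sym (lookup-index u∈L)
    ; restricts = λ _ _ → refl
    }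
  exact : ∀ x → ¬ Isolated (raw Q) (List.lookup L x)
  exact x = proj₂ (∈-filter⁻ (¬? ∘ isolated? Q) {xs = window Q} (∈-lookup {xs = L} x))

module _ (Q Q' : FinQ)
  (transfer : ∀ {C} → Support Q C → NoIsolated C → Σ MQ (λ C' → C ≈M C' × Support Q' C' × NoIsolated C'))
  (none⇒none' : NoArrows (raw Q) → NoArrows (raw Q'))
  (none'⇒none : NoArrows (raw Q') → NoArrows (raw Q)) where

  Rep-invariant : ∀ A A' → Rep Q A → Rep Q' A' → A ≈M A'
  Rep-invariant A A' (inj₁ r) (inj₁ r') =
    let (S , noIso) = arrows⇒support {Q} {A} r
        (S' , noIso') = arrows⇒support {Q'} {A'} r'
        (C , A≈C , SC , noIsoC) = transfer {A} S noIso
    in ≈M-trans {A} {C} {A'} A≈C (support-unique {Q'} {C} {A'} SC noIsoC S' noIso')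
  Rep-invariant A A' (inj₂ (_ , A≈1)) (inj₂ (_ , A'≈1)) =
    ≈M-trans {A} {oneVertex} {A'} A≈1 (≈M-sym {A'} {oneVertex} A'≈1)
  Rep-invariant A A' (inj₁ ((x , y , Qxy≢0) , _)) (inj₂ (none' , _)) =
    ⊥-elim (Qxy≢0 (none'⇒none none' x y))
  Rep-invariant A A' (inj₂ (none , _)) (inj₁ ((x , y , Q'xy≢0) , _)) =
    ⊥-elim (Q'xy≢0 (none⇒none' none x y))

Rep-∼⇒≈M : ∀ Q Q' A A' → Q ∼ Q' → Rep Q A → Rep Q' A' → A ≈M A'
Rep-∼⇒≈M Q Q' A A' (∼-mut s) =
  Rep-invariant Q Q' (λ {C} S noIso → support-MutStep {Q} {Q'} {C} S noIso s)
    (NoArrows-MutStep ℕP._≟_ s) (NoArrows-MutStep ℕP._≟_ (MutStep-reverse ℕP._≟_ (skewFin Q) s)) A A'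
Rep-∼⇒≈M Q Q' A A' (∼-iso (π , π-iso)) =
  Rep-invariant Q Q' (λ {C} (e , S) noIso → C , ≈M-refl {C} , (_ , support-iso S (π , π-iso)) , noIso)
    (λ none u v → trans (sym (cong₂ (raw Q') (strictlyInverseˡ u) (strictlyInverseˡ v)))
                        (trans (π-iso _ _) (none _ _)))
    (λ none' u v → trans (sym (π-iso u v)) (none' _ _)) A A'
  where open Inverse π
Rep-∼⇒≈M Q Q' A A' ∼-refl =
  Rep-invariant Q Q' (λ {C} S noIso → C , ≈M-refl {C} , S , noIso) (λ none → none) (λ none → none) A A'
Rep-∼⇒≈M Q Q' A A' (∼-sym Q'∼Q) rA rA' = ≈M-sym {A'} {A} (Rep-∼⇒≈M Q' Q A' A Q'∼Q rA' rA)
Rep-∼⇒≈M Q Q' A A' (∼-trans {Q' = Q''} Q∼Q'' Q''∼Q') rA rA' =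
  let (B , rB) = Rep-exists Q''
  in ≈M-trans {A} {B} {A'} (Rep-∼⇒≈M Q Q'' A B Q∼Q'' rA rB) (Rep-∼⇒≈M Q'' Q' B A' Q''∼Q' rB rA')

Rep-InM' : ∀ Q A → Rep Q A → InM' A
Rep-InM' Q A (inj₁ r)         = inj₁ (A , ≈M-refl {A} , proj₂ (arrows⇒support {Q} {A} r))
Rep-InM' Q A (inj₂ (_ , A≈1)) = inj₂ A≈1

Rep-injective : ∀ Q Q' A A' → Rep Q A → Rep Q' A' → A ≈M A' → Q ∼ Q'
Rep-injective Q Q' A A' rA rA' A≈A' =
  let (C , A≈C , SC) = Rep-support {Q} {A} rA
      (C' , A'≈C' , (_ , S')) = Rep-support {Q'} {A'} rA'
      C≈C' = ≈M-trans {C} {A} {C'} (≈M-sym {A} {C} A≈C) (≈M-trans {A} {A'} {C'} A≈A' A'≈C')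
      (Q₁ , Q∼Q₁ , (_ , S₁)) = support-≈M {Q} {C} {C'} SC C≈C'
  in ∼-trans Q∼Q₁ (support-∼ S₁ S')

emptyQ : FinQ
emptyQ = ((λ _ _ → 0ℤ) , λ _ _ → refl) , 0 , λ _ _ _ → refl

Rep-surjective : ∀ A → InM' A → Σ FinQ (λ Q → Σ MQ (λ B → Rep Q B × B ≈M A))
Rep-surjective A (inj₁ (B , A≈B , noIso)) =
  pushQ toℕ (qr B) (skewMQ B) , B ,
  support⇒Rep {_} {B} (toℕ , push-support (skewMQ B) FinP.toℕ-injective) noIso , ≈M-sym {A} {B} A≈B
Rep-surjective A (inj₂ A≈1) =
  emptyQ , oneVertex , NoArrows⇒Rep {emptyQ} (λ _ _ → refl) , ≈M-sym {A} {oneVertex} A≈1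

-- Continuity and openness

oneVertex-⊑ : ∀ B → oneVertex ⊑ B
oneVertex-⊑ B =
  (λ _ → vertex B) , (λ {x} {y} _ → Fin1-unique x y) , λ _ _ → sym (skew-diagonal (skewMQ B) (vertex B))

support-⊑ : ∀ {Q₀ Q A₀ C} → Support Q₀ A₀ → NoIsolated A₀ → Support Q C →
            AgreeOn (window Q₀) (proj₁ Q₀) (proj₁ Q) → A₀ ⊑ C
support-⊑ {Q₀} {Q} {A₀} {C} (e₀ , S₀) noIso₀ (e , S) agree = ι , ι-injective , ι-restricts
  where
  agree₀ : ∀ x y → raw Q (e₀ x) (e₀ y) ≡ raw Q₀ (e₀ x) (e₀ y)
  agree₀ x y = agree _ _ (nonIsolated∈window Q₀ (noIsolated⇒exact S₀ noIso₀ x))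
                         (nonIsolated∈window Q₀ (noIsolated⇒exact S₀ noIso₀ y))
  exact : ∀ x → ¬ Isolated (raw Q) (e₀ x)
  exact x iso = let (y , A₀xy≢0) = nonIsolated⇒neighbour (qr A₀) (noIso₀ x)
                in A₀xy≢0 (trans (restricts S₀ x y) (trans (sym (agree₀ x y)) (iso (e₀ y))))
  ι : Fin (n A₀) → Fin (n C)
  ι x = proj₁ (covers S (exact x))
  e∘ι : ∀ x → e (ι x) ≡ e₀ x
  e∘ι x = proj₂ (covers S (exact x))
  ι-injective : Injective _≡_ _≡_ ι
  ι-injective {x} {y} eq = injective S₀ (trans (sym (e∘ι x)) (trans (cong e eq) (e∘ι y)))
  ι-restricts : ∀ x y → qr A₀ x y ≡ qr C (ι x) (ι y)
  ι-restricts x y = begin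
    qr A₀ x y                  ≡⟨ restricts S₀ x y ⟩
    raw Q₀ (e₀ x) (e₀ y)       ≡⟨ sym (agree₀ x y) ⟩
    raw Q (e₀ x) (e₀ y)        ≡⟨ sym (cong₂ (raw Q) (e∘ι x) (e∘ι y)) ⟩
    raw Q (e (ι x)) (e (ι y))  ≡⟨ sym (restricts S (ι x) (ι y)) ⟩
    qr C (ι x) (ι y)           ∎
    where open ≡-Reasoning

Rep-⪯ : ∀ Q₀ Q A₀ A → Rep Q₀ A₀ → Rep Q A → AgreeOn (window Q₀) (proj₁ Q₀) (proj₁ Q) → A₀ ⪯ A
Rep-⪯ Q₀ Q A₀ A (inj₂ (_ , A₀≈1)) _ _ = oneVertex , A , A₀≈1 , ≈M-refl {A} , oneVertex-⊑ A
Rep-⪯ Q₀ Q A₀ A (inj₁ r₀) rA agree =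
  let (S₀ , noIso₀) = arrows⇒support {Q₀} {A₀} r₀
      (C , A≈C , SC) = Rep-support {Q} {A} rA
  in A₀ , C , ≈M-refl {A₀} , A≈C , support-⊑ {Q₀} {Q} {A₀} {C} S₀ noIso₀ SC agree

Rep-continuous : ∀ W → UpClosed W → OpenFin (λ Q → Σ MQ (λ A → Rep Q A × W A))
Rep-continuous W up =
  O , O-open , λ Q → (λ (A , rA , wA) → Q , A , rA , wA , λ _ _ _ _ → refl) , O⇒preimage Q
  where
  O : AF → Set
  O P = Σ FinQ (λ Q₀ → Σ MQ (λ A₀ → Rep Q₀ A₀ × W A₀ × AgreeOn (window Q₀) (proj₁ Q₀) P))
  O-open : OpenAF O
  O-open P (Q₀ , A₀ , r₀ , w₀ , agree) =
    window Q₀ , λ P' agree' →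
      Q₀ , A₀ , r₀ , w₀ , λ x y x∈ y∈ → trans (agree' x y x∈ y∈) (agree x y x∈ y∈)
  O⇒preimage : ∀ Q → O (proj₁ Q) → Σ MQ (λ A → Rep Q A × W A)
  O⇒preimage Q (Q₀ , A₀ , r₀ , w₀ , agree) =
    let (A , rA) = Rep-exists Q in A , rA , up A₀ A w₀ (Rep-⪯ Q₀ Q A₀ A r₀ rA agree)

module Extension {Q : FinQ} {C D : MQ} {e : Fin (n C) → ℕ} (S : SupportEmbedding Q (qr C) e)
                 {ι : Fin (n C) → Fin (n D)} (ι-injective : Injective _≡_ _≡_ ι)
                 (ι-restricts : ∀ x y → qr C x y ≡ qr D (ι x) (ι y)) (V : List ℕ) where

  -- Vertices of D outside the image of ι are sent beyond V and the image of e.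
  M : ℕ
  M = ℕ.suc (max 0 V ℕ.⊔ maxImage e)

  V<M : ∀ {u} → u ∈ V → u ℕ.< M
  V<M u∈V = ℕ.s≤s (ℕP.≤-trans (All.lookup (xs≤max 0 V) u∈V) (ℕP.m≤m⊔n _ _))

  e<M : ∀ x → e x ℕ.< M
  e<M x = ℕ.s≤s (ℕP.≤-trans (≤maxImage e x) (ℕP.m≤n⊔m _ _))

  e' : Fin (n D) → ℕ
  e' y with FinP.any? (λ x → ι x FinP.≟ y)
  ... | yes (x , _) = e x
  ... | no _        = M ℕ.+ toℕ y

  e'-view : ∀ y → Σ (Fin (n C)) (λ x → ι x ≡ y × e' y ≡ e x)
                ⊎ (¬ Σ (Fin (n C)) (λ x → ι x ≡ y) × e' y ≡ M ℕ.+ toℕ y)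
  e'-view y with FinP.any? (λ x → ι x FinP.≟ y)
  ... | yes (x , ιx≡y) = inj₁ (x , ιx≡y , refl)
  ... | no ∉ι          = inj₂ (∉ι , refl)

  e'∘ι : ∀ x → e' (ι x) ≡ e x
  e'∘ι x with e'-view (ι x)
  ... | inj₁ (x' , ιx'≡ιx , e'ιx≡ex') = trans e'ιx≡ex' (cong e (ι-injective ιx'≡ιx))
  ... | inj₂ (∉ι , _)                 = ⊥-elim (∉ι (x , refl))

  outside-large : ∀ {u y} → e' y ≡ M ℕ.+ toℕ y → e' y ≡ u → M ℕ.≤ u
  outside-large {y = y} e'y≡ e'y≡u = subst (M ℕ.≤_) (trans (sym e'y≡) e'y≡u) (ℕP.m≤m+n M (toℕ y))

  e'-injective : Injective _≡_ _≡_ e'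
  e'-injective {y} {y'} eq with e'-view y | e'-view y'
  ... | inj₁ (x , refl , e'y≡ex) | inj₁ (x' , refl , e'y'≡ex') =
          cong ι (injective S (trans (sym e'y≡ex) (trans eq e'y'≡ex')))
  ... | inj₁ (x , _ , e'y≡ex) | inj₂ (_ , e'y'≡) =
          ⊥-elim (ℕP.<⇒≱ (e<M x) (outside-large e'y'≡ (trans (sym eq) e'y≡ex)))
  ... | inj₂ (_ , e'y≡) | inj₁ (x' , _ , e'y'≡ex') =
          ⊥-elim (ℕP.<⇒≱ (e<M x') (outside-large e'y≡ (trans eq e'y'≡ex')))
  ... | inj₂ (_ , e'y≡) | inj₂ (_ , e'y'≡) =
          FinP.toℕ-injective (ℕP.+-cancelˡ-≡ M _ _ (trans (sym e'y≡) (trans eq e'y'≡)))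

  image-below-M : ∀ {u} → u ℕ.< M → Image e' u → Image e u
  image-below-M u<M (y , e'y≡u) with e'-view y
  ... | inj₁ (x , _ , e'y≡ex) = x , trans (sym e'y≡ex) e'y≡u
  ... | inj₂ (_ , e'y≡)       = ⊥-elim (ℕP.<⇒≱ u<M (outside-large e'y≡ e'y≡u))

  Q' : FinQ
  Q' = pushQ e' (qr D) (skewMQ D)

  S' : SupportEmbedding Q' (qr D) e'
  S' = push-support (skewMQ D) e'-injective

  agree : AgreeOn V (proj₁ Q) (proj₁ Q')
  agree u v u∈V v∈V with image? e u | image? e v
  ... | yes (x , refl) | yes (y , refl) = begin
    push e' (qr D) (e x) (e y)           ≡⟨ sym (cong₂ (push e' (qr D)) (e'∘ι x) (e'∘ι y)) ⟩
    push e' (qr D) (e' (ι x)) (e' (ι y)) ≡⟨ push-image e'-injective (ι x) (ι y) ⟩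
    qr D (ι x) (ι y)                     ≡⟨ sym (ι-restricts x y) ⟩
    qr C x y                             ≡⟨ restricts S x y ⟩
    raw Q (e x) (e y)                    ∎
    where open ≡-Reasoning
  ... | no ∉e | _ =
    trans (push-outside (∉e ∘ image-below-M (V<M u∈V)) v) (sym (outside-isolated S ∉e v))
  ... | yes _ | no ∉e =
    trans (skew-isolated (push-skew (skewMQ D)) (push-outside (∉e ∘ image-below-M (V<M v∈V))) u)
          (sym (skew-isolated (skewFin Q) (outside-isolated S ∉e) u))

support-extend : ∀ {Q C D} → Support Q C → C ⊑ D → (V : List ℕ) →
                 Σ FinQ (λ Q' → AgreeOn V (proj₁ Q) (proj₁ Q') × Support Q' D)
support-extend {Q} {C} {D} (_ , S) (_ , ι-injective , ι-restricts) V = Q' , agree , _ , S'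
  where open Extension {Q} {C} {D} S ι-injective ι-restricts V

module _ (U : FinQ → Set) (U-saturated : Saturated U) (U-open : OpenFin U) where

  SupportedIn : MQ → Set
  SupportedIn C = Σ FinQ (λ Q → U Q × Support Q C)

  SupportedIn-≈M : ∀ {C D} → SupportedIn C → C ≈M D → SupportedIn D
  SupportedIn-≈M {C} {D} (Q , Q∈U , S) C≈D =
    let (Q' , Q∼Q' , S') = support-≈M {Q} {C} {D} S C≈D in Q' , U-saturated Q Q' Q∼Q' Q∈U , S'

  SupportedIn-⊑ : ∀ {C D} → SupportedIn C → C ⊑ D → SupportedIn D
  SupportedIn-⊑ {C} {D} (Q , Q∈U , S) C⊑D =
    let (O , O-open , U⇔O) = U-open
        (V , V-nbhd) = O-open (proj₁ Q) (proj₁ (U⇔O Q) Q∈U)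
        (Q' , agree , S') = support-extend {Q} {C} {D} S C⊑D V
    in Q' , proj₂ (U⇔O Q') (V-nbhd (proj₁ Q') agree) , S'

  SupportedIn-upClosed : UpClosed SupportedIn
  SupportedIn-upClosed A B reached (A' , B' , A≈A' , B≈B' , A'⊑B') =
    SupportedIn-≈M {B'} {B} (SupportedIn-⊑ {A'} {B'} (SupportedIn-≈M {A} {A'} reached A≈A') A'⊑B')
                            (≈M-sym {B} {B'} B≈B')

  SupportedIn⇔image : ∀ A → InM' A → SupportedIn A iff Σ FinQ (λ Q → U Q × Σ MQ (λ B → Rep Q B × B ≈M A))
  SupportedIn⇔image A m = reached⇒image m , image⇒reached
    where
    reached⇒image : InM' A → SupportedIn A → Σ FinQ (λ Q → U Q × Σ MQ (λ B → Rep Q B × B ≈M A))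
    reached⇒image (inj₁ (B , A≈B , noIso)) reached =
      let (Q , Q∈U , S) = SupportedIn-≈M {A} {B} reached A≈B
      in Q , Q∈U , B , support⇒Rep {Q} {B} S noIso , ≈M-sym {A} {B} A≈B
    reached⇒image (inj₂ A≈1) reached =
      let (Q , Q∈U , (_ , S)) = SupportedIn-≈M {A} {oneVertex} reached A≈1
      in Q , Q∈U , oneVertex , NoArrows⇒Rep {Q} (support-Fin1⇒NoArrows S) , ≈M-sym {A} {oneVertex} A≈1
    image⇒reached : Σ FinQ (λ Q → U Q × Σ MQ (λ B → Rep Q B × B ≈M A)) → SupportedIn A
    image⇒reached (Q , Q∈U , B , rB , B≈A) =
      let (C , B≈C , S) = Rep-support {Q} {B} rB
      in SupportedIn-≈M {C} {A} (Q , Q∈U , S) (≈M-trans {C} {B} {A} (≈M-sym {B} {C} B≈C) B≈A)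

  Rep-open : Σ (MQ → Set) (λ W → UpClosed W ×
               (∀ A → InM' A → W A iff Σ FinQ (λ Q → U Q × Σ MQ (λ B → Rep Q B × B ≈M A))))
  Rep-open = SupportedIn , SupportedIn-upClosed , SupportedIn⇔image

theorem1p7 :
    -- f is defined on every class
    (∀ (Q : FinQ) → Σ MQ (λ A → Rep Q A))
    -- f is well defined on Fin/∼
  × (∀ (Q Q' : FinQ) (A A' : MQ) → Q ∼ Q' → Rep Q A → Rep Q' A' → A ≈M A')
    -- f lands in 𝓜'
  × (∀ (Q : FinQ) (A : MQ) → Rep Q A → InM' A)
    -- f is injective on Fin/∼
  × (∀ (Q Q' : FinQ) (A A' : MQ) → Rep Q A → Rep Q' A' → A ≈M A' → Q ∼ Q')
    -- f is surjective onto 𝓜'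
  × (∀ (A : MQ) → InM' A → Σ FinQ (λ Q → Σ MQ (λ B → Rep Q B × B ≈M A)))
    -- f is continuous: preimage of (W ∩ 𝓜'), W upward closed, is open in Fin/∼
  × (∀ (W : MQ → Set) → UpClosed W →
       OpenFin (λ Q → Σ MQ (λ A → Rep Q A × W A)))
    -- f is open: image of an open subset of Fin/∼ is open in 𝓜'
  × (∀ (U : FinQ → Set) → Saturated U → OpenFin U →
       Σ (MQ → Set) (λ W → UpClosed W ×
         (∀ (A : MQ) → InM' A →
            W A iff Σ FinQ (λ Q → U Q × Σ MQ (λ B → Rep Q B × B ≈M A)))))
theorem1p7 =
  Rep-exists , Rep-∼⇒≈M , Rep-InM' , Rep-injective , Rep-surjective , Rep-continuous , Rep-open
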